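{- For every instance $\mathcal I$, $\mathsf{OFF}(\mathcal I)\le\mathsf{LP}^{\mathsf{trunc}}(\mathcal I)$.
   Context: An instance $\mathcal{I}$ consists of: positive integers $n$ (resources) and $m$ (query types); rewards $r_{i,j}\ge 0$; integer capacities $k_i\ge1$; and a random demand vector $\mathbf D=(D_1,\dots,D_m)$ of nonnegative integers with a known distribution (with finite support). $\mathsf{OFF}_{\mathcal I}(\mathbf D)$ is the maximum of $\sum_{i,j}r_{i,j}x_{i,j}$ over $x\ge0$ with $\sum_j x_{i,j}\le k_i$ for all $i$ and $\sum_i x_{i,j}\le D_j$ for all $j$, and $\mathsf{OFF}(\mathcal I)=\mathbb E[\mathsf{OFF}_{\mathcal I}(\mathbf D)]$. $\mathsf{LP}^{\mathsf{trunc}}(\mathcal I)$ is the optimal value of: maximize $\sum_{i,j}r_{i,j}x_{i,j}$ subject to $\sum_{j=1}^m x_{i,j}\le k_i$ for all $i\in[n]$; $\sum_{i\in S}x_{i,j}\le\mathbb E[\min\{D_j,\sum_{i\in S}k_i\}]$ for all $S\subseteq[n]$, $j\in[m]$; $x_{i,j}\ge0$.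
   Formalization: The rewards $r_{i,j}$ and the probabilities of the demand distribution are rational, and the variables $x_{i,j}$ of both linear programs are taken in ℚ. -}

module Defs where

open import Data.Nat as ℕ using (ℕ; zero; suc; _⊓_)
open import Data.Integer using (+_)
open import Data.Rational using (ℚ; 0ℚ; 1ℚ; _+_; _*_; _≤_; _/_)
open import Data.Fin using (Fin; zero; suc)
open import Data.Fin.Subset using (Subset; Side; inside; outside)
open import Data.Vec using (lookup)
open import Data.List using (List; []; _∷_)
open import Data.Product using (_×_; _,_; proj₁)
open import Relation.Binary.PropositionalEquality using (_≡_)

ℕtoℚ : ℕ → ℚ
ℕtoℚ k = + k / 1

Σℚ : (n : ℕ) → (Fin n → ℚ) → ℚ
Σℚ zero    f = 0ℚ
Σℚ (suc n) f = f zero + Σℚ n (λ i → f (suc i))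

Σℕ : (n : ℕ) → (Fin n → ℕ) → ℕ
Σℕ zero    f = 0
Σℕ (suc n) f = f zero ℕ.+ Σℕ n (λ i → f (suc i))

restrictℚ : Side → ℚ → ℚ
restrictℚ inside  q = q
restrictℚ outside q = 0ℚ

restrictℕ : Side → ℕ → ℕ
restrictℕ inside  q = q
restrictℕ outside q = 0

ΣSℚ : (n : ℕ) → Subset n → (Fin n → ℚ) → ℚ
ΣSℚ n S f = Σℚ n (λ i → restrictℚ (lookup S i) (f i))

ΣSℕ : (n : ℕ) → Subset n → (Fin n → ℕ) → ℕ
ΣSℕ n S f = Σℕ n (λ i → restrictℕ (lookup S i) (f i))

-- A finitely supported distribution on demand vectors ℕ^m:
-- a list of (probability, outcome) pairs.
Dist : ℕ → Set
Dist m = List (ℚ × (Fin m → ℕ))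

totalMass : ∀ {m} → Dist m → ℚ
totalMass []            = 0ℚ
totalMass ((p , _) ∷ μ) = p + totalMass μ

data NonnegProbs {m : ℕ} : Dist m → Set where
  []  : NonnegProbs []
  _∷_ : ∀ {p d μ} → 0ℚ ≤ p → NonnegProbs μ → NonnegProbs ((p , d) ∷ μ)

𝔼 : ∀ {m} → Dist m → ((Fin m → ℕ) → ℚ) → ℚ
𝔼 []            f = 0ℚ
𝔼 ((p , d) ∷ μ) f = p * f d + 𝔼 μ f

record Instance : Set where
  field
    n m      : ℕ
    r        : Fin n → Fin m → ℚ
    r≥0      : ∀ i j → 0ℚ ≤ r i j
    k        : Fin n → ℕ
    k≥1      : ∀ i → 1 ℕ.≤ k i
    D        : Dist m
    D-nonneg : NonnegProbs D
    D-mass   : totalMass D ≡ 1ℚ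

open Instance

Alloc : Instance → Set
Alloc I = Fin (n I) → Fin (m I) → ℚ

obj : (I : Instance) → Alloc I → ℚ
obj I x = Σℚ (n I) (λ i → Σℚ (m I) (λ j → r I i j * x i j))

OffFeasible : (I : Instance) → (Fin (m I) → ℕ) → Alloc I → Set
OffFeasible I d x =
  (∀ i j → 0ℚ ≤ x i j) ×
  (∀ i → Σℚ (m I) (λ j → x i j) ≤ ℕtoℚ (k I i)) ×
  (∀ j → Σℚ (n I) (λ i → x i j) ≤ ℕtoℚ (d j))

TruncFeasible : (I : Instance) → Alloc I → Set
TruncFeasible I x =
  (∀ i j → 0ℚ ≤ x i j) ×
  (∀ i → Σℚ (m I) (λ j → x i j) ≤ ℕtoℚ (k I i)) ×
  (∀ (S : Subset (n I)) j →
     ΣSℚ (n I) S (λ i → x i j)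
       ≤ 𝔼 (D I) (λ d → ℕtoℚ (d j ⊓ ΣSℕ (n I) S (k I))))

-- Let y := 𝔼[x^D] be the average of the offline solutions. The objective is linear, so
-- obj y = 𝔼[obj x^D]. Each constraint of LP^trunc is a linear inequality in x that every
-- x^d satisfies pointwise: Σ_{i∈S} x^d_{ij} is at most the demand d_j and, through the
-- capacities, at most Σ_{i∈S} k_i, hence at most their minimum. Taking expectations
-- (with nonnegative weights of total mass 1) preserves these inequalities.
module Submission where

open import Defs
open import Data.Nat using (ℕ; zero; suc)
open import Data.Fin using (Fin)
open import Data.Product using (Σ; _×_)
open import Data.Rational using (_≤_)

open import Algebra.Bundles using (CommutativeMonoid)
import Algebra.Properties.CommutativeSemigroup as CommSemigroupProperties
import Data.Nat as ℕ
import Data.Nat.Properties as ℕ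
import Data.Integer as ℤ
import Data.Integer.Properties as ℤ
open import Data.Fin using (zero; suc)
open import Data.Fin.Subset using (inside; outside)
open import Data.Vec using (lookup)
open import Data.List using ([]; _∷_)
open import Data.Product using (_,_; proj₁; proj₂)
open import Function using (_∘_)
open import Data.Sum using (inj₁; inj₂)
open import Data.Rational using (ℚ; 0ℚ; 1ℚ; _+_; _*_; nonNegative; toℚᵘ)
open import Data.Rational.Properties
import Data.Rational.Unnormalised as ℚᵘ
import Data.Rational.Unnormalised.Properties as ℚᵘ
open import Relation.Binary.PropositionalEquality

open CommSemigroupProperties (CommutativeMonoid.commutativeSemigroup +-0-commutativeMonoid)
  using (interchange)
open CommSemigroupProperties (CommutativeMonoid.commutativeSemigroup *-1-commutativeMonoid)
  using (x∙yz≈y∙xz)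

-- ℕtoℚ a = + a / 1 unfolds to fromℚᵘ (mkℚᵘ (+ a) 0).
toℚᵘ-ℕtoℚ : ∀ a → toℚᵘ (ℕtoℚ a) ℚᵘ.≃ ℚᵘ.mkℚᵘ (ℤ.+ a) 0
toℚᵘ-ℕtoℚ a = toℚᵘ-fromℚᵘ (ℚᵘ.mkℚᵘ (ℤ.+ a) 0)

ℕtoℚ-+ : ∀ a b → ℕtoℚ (a ℕ.+ b) ≡ ℕtoℚ a + ℕtoℚ b
ℕtoℚ-+ a b = toℚᵘ-injective (begin
  toℚᵘ (ℕtoℚ (a ℕ.+ b))                    ≈⟨ toℚᵘ-ℕtoℚ (a ℕ.+ b) ⟩
  ℚᵘ.mkℚᵘ (ℤ.+ (a ℕ.+ b)) 0                ≈⟨ ℚᵘ.*≡* (cong (ℤ._* ℤ.+ 1) numerators≡) ⟩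
  ℚᵘ.mkℚᵘ (ℤ.+ a) 0 ℚᵘ.+ ℚᵘ.mkℚᵘ (ℤ.+ b) 0  ≈⟨ ℚᵘ.+-cong (toℚᵘ-ℕtoℚ a) (toℚᵘ-ℕtoℚ b) ⟨
  toℚᵘ (ℕtoℚ a) ℚᵘ.+ toℚᵘ (ℕtoℚ b)         ≈⟨ toℚᵘ-homo-+ (ℕtoℚ a) (ℕtoℚ b) ⟨
  toℚᵘ (ℕtoℚ a + ℕtoℚ b)                   ∎)
  where
  open ℚᵘ.≃-Reasoning
  numerators≡ : ℤ.+ (a ℕ.+ b) ≡ ℤ.+ a ℤ.* ℤ.+ 1 ℤ.+ ℤ.+ b ℤ.* ℤ.+ 1
  numerators≡ = sym (cong₂ ℤ._+_ (ℤ.*-identityʳ (ℤ.+ a)) (ℤ.*-identityʳ (ℤ.+ b)))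

p≤p+q : ∀ p {q} → 0ℚ ≤ q → p ≤ p + q
p≤p+q p {q} 0≤q = subst (_≤ p + q) (+-identityʳ p) (+-monoʳ-≤ p 0≤q)

≤-ℕtoℚ-⊓ : ∀ {q} a b → q ≤ ℕtoℚ a → q ≤ ℕtoℚ b → q ≤ ℕtoℚ (a ℕ.⊓ b)
≤-ℕtoℚ-⊓ a b q≤a q≤b with ℕ.⊓-sel a b
... | inj₁ a⊓b≡a rewrite a⊓b≡a = q≤a
... | inj₂ a⊓b≡b rewrite a⊓b≡b = q≤b

Σℚ-cong : ∀ n {f g : Fin n → ℚ} → (∀ i → f i ≡ g i) → Σℚ n f ≡ Σℚ n g
Σℚ-cong zero    f≡g = refl
Σℚ-cong (suc n) f≡g = cong₂ _+_ (f≡g zero) (Σℚ-cong n (λ i → f≡g (suc i)))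

Σℚ-mono-≤ : ∀ n {f g : Fin n → ℚ} → (∀ i → f i ≤ g i) → Σℚ n f ≤ Σℚ n g
Σℚ-mono-≤ zero    f≤g = ≤-refl
Σℚ-mono-≤ (suc n) f≤g = +-mono-≤ (f≤g zero) (Σℚ-mono-≤ n (λ i → f≤g (suc i)))

Σℚ-zero : ∀ n → Σℚ n (λ _ → 0ℚ) ≡ 0ℚ
Σℚ-zero zero    = refl
Σℚ-zero (suc n) = trans (cong (0ℚ +_) (Σℚ-zero n)) (+-identityˡ 0ℚ)

Σℚ-nonNeg : ∀ n {f : Fin n → ℚ} → (∀ i → 0ℚ ≤ f i) → 0ℚ ≤ Σℚ n f
Σℚ-nonNeg n {f} 0≤f = subst (_≤ Σℚ n f) (Σℚ-zero n) (Σℚ-mono-≤ n 0≤f)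

term≤Σℚ : ∀ n {f : Fin n → ℚ} → (∀ i → 0ℚ ≤ f i) → ∀ j → f j ≤ Σℚ n f
term≤Σℚ (suc n) 0≤f zero    = p≤p+q _ (Σℚ-nonNeg n (λ i → 0≤f (suc i)))
term≤Σℚ (suc n) {f} 0≤f (suc j) = begin
  f (suc j)                         ≤⟨ term≤Σℚ n (λ i → 0≤f (suc i)) j ⟩
  Σℚ n (λ i → f (suc i))            ≡⟨ +-identityˡ _ ⟨
  0ℚ + Σℚ n (λ i → f (suc i))       ≤⟨ +-monoˡ-≤ _ (0≤f zero) ⟩
  f zero + Σℚ n (λ i → f (suc i))   ∎
  where open ≤-Reasoning

ℕtoℚ-Σ : ∀ n (f : Fin n → ℕ) → ℕtoℚ (Σℕ n f) ≡ Σℚ n (λ i → ℕtoℚ (f i))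
ℕtoℚ-Σ zero    f = refl
ℕtoℚ-Σ (suc n) f =
  trans (ℕtoℚ-+ (f zero) _) (cong (ℕtoℚ (f zero) +_) (ℕtoℚ-Σ n (λ i → f (suc i))))

restrictℚ-≤ : ∀ s {q} → 0ℚ ≤ q → restrictℚ s q ≤ q
restrictℚ-≤ inside  0≤q = ≤-refl
restrictℚ-≤ outside 0≤q = 0≤q

restrictℚ-mono-≤ : ∀ s {p q} → p ≤ q → restrictℚ s p ≤ restrictℚ s q
restrictℚ-mono-≤ inside  p≤q = p≤q
restrictℚ-mono-≤ outside p≤q = ≤-refl

ℕtoℚ-restrict : ∀ s a → ℕtoℚ (restrictℕ s a) ≡ restrictℚ s (ℕtoℚ a)
ℕtoℚ-restrict inside  a = refl
ℕtoℚ-restrict outside a = refl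

ΣSℚ≤Σℚ : ∀ n S {f : Fin n → ℚ} → (∀ i → 0ℚ ≤ f i) → ΣSℚ n S f ≤ Σℚ n f
ΣSℚ≤Σℚ n S 0≤f = Σℚ-mono-≤ n (λ i → restrictℚ-≤ (lookup S i) (0≤f i))

ΣSℚ-mono-≤ : ∀ n S {f g : Fin n → ℚ} → (∀ i → f i ≤ g i) → ΣSℚ n S f ≤ ΣSℚ n S g
ΣSℚ-mono-≤ n S f≤g = Σℚ-mono-≤ n (λ i → restrictℚ-mono-≤ (lookup S i) (f≤g i))

ℕtoℚ-ΣS : ∀ n S (f : Fin n → ℕ) → ℕtoℚ (ΣSℕ n S f) ≡ ΣSℚ n S (λ i → ℕtoℚ (f i))
ℕtoℚ-ΣS n S f =
  trans (ℕtoℚ-Σ n _) (Σℚ-cong n (λ i → ℕtoℚ-restrict (lookup S i) (f i)))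

module _ {m : ℕ} where

  𝔼-+ : ∀ (μ : Dist m) f g → 𝔼 μ (λ d → f d + g d) ≡ 𝔼 μ f + 𝔼 μ g
  𝔼-+ []            f g = sym (+-identityˡ 0ℚ)
  𝔼-+ ((p , d) ∷ μ) f g =
    trans (cong₂ _+_ (*-distribˡ-+ p (f d) (g d)) (𝔼-+ μ f g))
          (interchange (p * f d) (p * g d) (𝔼 μ f) (𝔼 μ g))

  𝔼-zero : ∀ (μ : Dist m) → 𝔼 μ (λ _ → 0ℚ) ≡ 0ℚ
  𝔼-zero []            = refl
  𝔼-zero ((p , d) ∷ μ) = trans (cong₂ _+_ (*-zeroʳ p) (𝔼-zero μ)) (+-identityˡ 0ℚ)

  𝔼-const : ∀ (μ : Dist m) c → 𝔼 μ (λ _ → c) ≡ c * totalMass μ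
  𝔼-const []            c = sym (*-zeroʳ c)
  𝔼-const ((p , d) ∷ μ) c =
    trans (cong₂ _+_ (*-comm p c) (𝔼-const μ c)) (sym (*-distribˡ-+ c p (totalMass μ)))

  𝔼-scale : ∀ (μ : Dist m) c f → 𝔼 μ (λ d → c * f d) ≡ c * 𝔼 μ f
  𝔼-scale []            c f = sym (*-zeroʳ c)
  𝔼-scale ((p , d) ∷ μ) c f =
    trans (cong₂ _+_ (x∙yz≈y∙xz p c (f d)) (𝔼-scale μ c f))
          (sym (*-distribˡ-+ c (p * f d) (𝔼 μ f)))

  𝔼-Σℚ : ∀ (μ : Dist m) n (f : (Fin m → ℕ) → Fin n → ℚ) →
         𝔼 μ (λ d → Σℚ n (f d)) ≡ Σℚ n (λ i → 𝔼 μ (λ d → f d i))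
  𝔼-Σℚ μ zero    f = 𝔼-zero μ
  𝔼-Σℚ μ (suc n) f =
    trans (𝔼-+ μ (λ d → f d zero) (λ d → Σℚ n (λ i → f d (suc i))))
          (cong (𝔼 μ (λ d → f d zero) +_) (𝔼-Σℚ μ n (λ d i → f d (suc i))))

  𝔼-restrict : ∀ (μ : Dist m) s f → 𝔼 μ (λ d → restrictℚ s (f d)) ≡ restrictℚ s (𝔼 μ f)
  𝔼-restrict μ inside  f = refl
  𝔼-restrict μ outside f = 𝔼-zero μ

  𝔼-ΣSℚ : ∀ (μ : Dist m) n S (f : (Fin m → ℕ) → Fin n → ℚ) →
          𝔼 μ (λ d → ΣSℚ n S (f d)) ≡ ΣSℚ n S (λ i → 𝔼 μ (λ d → f d i))
  𝔼-ΣSℚ μ n S f =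
    trans (𝔼-Σℚ μ n (λ d i → restrictℚ (lookup S i) (f d i)))
          (Σℚ-cong n (λ i → 𝔼-restrict μ (lookup S i) (λ d → f d i)))

  𝔼-mono-≤ : ∀ {μ : Dist m} → NonnegProbs μ → ∀ {f g} → (∀ d → f d ≤ g d) → 𝔼 μ f ≤ 𝔼 μ g
  𝔼-mono-≤ []        f≤g = ≤-refl
  𝔼-mono-≤ {(p , d) ∷ μ} (0≤p ∷ μ≥0) f≤g =
    +-mono-≤ (*-monoˡ-≤-nonNeg p {{nonNegative 0≤p}} (f≤g d)) (𝔼-mono-≤ μ≥0 f≤g)

  𝔼-nonNeg : ∀ {μ : Dist m} → NonnegProbs μ → ∀ {f} → (∀ d → 0ℚ ≤ f d) → 0ℚ ≤ 𝔼 μ f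
  𝔼-nonNeg {μ} μ≥0 {f} 0≤f = subst (_≤ 𝔼 μ f) (𝔼-zero μ) (𝔼-mono-≤ μ≥0 0≤f)

module _ (I : Instance) where
  open Instance I

  expectedAlloc : ((Fin m → ℕ) → Alloc I) → Alloc I
  expectedAlloc xs i j = 𝔼 D (λ d → xs d i j)

  𝔼-obj : ∀ xs → 𝔼 D (λ d → obj I (xs d)) ≡ obj I (expectedAlloc xs)
  𝔼-obj xs = begin
    𝔼 D (λ d → Σℚ n (λ i → Σℚ m (λ j → r i j * xs d i j)))
      ≡⟨ 𝔼-Σℚ D n (λ d i → Σℚ m (λ j → r i j * xs d i j)) ⟩
    Σℚ n (λ i → 𝔼 D (λ d → Σℚ m (λ j → r i j * xs d i j)))
      ≡⟨ Σℚ-cong n (λ i → 𝔼-Σℚ D m (λ d j → r i j * xs d i j)) ⟩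
    Σℚ n (λ i → Σℚ m (λ j → 𝔼 D (λ d → r i j * xs d i j)))
      ≡⟨ Σℚ-cong n (λ i → Σℚ-cong m (λ j → 𝔼-scale D (r i j) (λ d → xs d i j))) ⟩
    Σℚ n (λ i → Σℚ m (λ j → r i j * expectedAlloc xs i j))
      ∎
    where open ≡-Reasoning

  offFeasible⇒truncated-demand : ∀ d {x} → OffFeasible I d x → ∀ S j →
    ΣSℚ n S (λ i → x i j) ≤ ℕtoℚ (d j ℕ.⊓ ΣSℕ n S k)
  offFeasible⇒truncated-demand d {x} (x≥0 , row≤k , col≤d) S j =
    ≤-ℕtoℚ-⊓ (d j) (ΣSℕ n S k) ≤demand ≤capacity
    where
    open ≤-Reasoning
    ≤demand : ΣSℚ n S (λ i → x i j) ≤ ℕtoℚ (d j)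
    ≤demand = ≤-trans (ΣSℚ≤Σℚ n S (λ i → x≥0 i j)) (col≤d j)
    ≤capacity : ΣSℚ n S (λ i → x i j) ≤ ℕtoℚ (ΣSℕ n S k)
    ≤capacity = begin
      ΣSℚ n S (λ i → x i j)      ≤⟨ ΣSℚ-mono-≤ n S (λ i → ≤-trans (term≤Σℚ m (x≥0 i) j) (row≤k i)) ⟩
      ΣSℚ n S (ℕtoℚ ∘ k)         ≡⟨ ℕtoℚ-ΣS n S k ⟨
      ℕtoℚ (ΣSℕ n S k)           ∎

  expectedAlloc-truncFeasible : ∀ {xs} → (∀ d → OffFeasible I d (xs d)) →
                                TruncFeasible I (expectedAlloc xs)
  expectedAlloc-truncFeasible {xs} feasible = y≥0 , row≤k , truncated
    where
    y≥0 : ∀ i j → 0ℚ ≤ expectedAlloc xs i j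
    y≥0 i j = 𝔼-nonNeg D-nonneg (λ d → proj₁ (feasible d) i j)

    row≤k : ∀ i → Σℚ m (expectedAlloc xs i) ≤ ℕtoℚ (k i)
    row≤k i = begin
      Σℚ m (expectedAlloc xs i)          ≡⟨ 𝔼-Σℚ D m (λ d → xs d i) ⟨
      𝔼 D (λ d → Σℚ m (xs d i))          ≤⟨ 𝔼-mono-≤ D-nonneg (λ d → proj₁ (proj₂ (feasible d)) i) ⟩
      𝔼 D (λ _ → ℕtoℚ (k i))             ≡⟨ 𝔼-const D (ℕtoℚ (k i)) ⟩
      ℕtoℚ (k i) * totalMass D           ≡⟨ cong (ℕtoℚ (k i) *_) D-mass ⟩
      ℕtoℚ (k i) * 1ℚ                    ≡⟨ *-identityʳ (ℕtoℚ (k i)) ⟩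
      ℕtoℚ (k i)                         ∎
      where open ≤-Reasoning

    truncated : ∀ S j → ΣSℚ n S (λ i → expectedAlloc xs i j)
                          ≤ 𝔼 D (λ d → ℕtoℚ (d j ℕ.⊓ ΣSℕ n S k))
    truncated S j = subst (_≤ 𝔼 D (λ d → ℕtoℚ (d j ℕ.⊓ ΣSℕ n S k)))
      (𝔼-ΣSℚ D n S (λ d i → xs d i j))
      (𝔼-mono-≤ D-nonneg (λ d → offFeasible⇒truncated-demand d (feasible d) S j))

lemma1 : (I : Instance)
    → (xs : (d : Fin (Instance.m I) → ℕ) → Alloc I)
    → ((d : Fin (Instance.m I) → ℕ) → OffFeasible I d (xs d))
    → Σ (Alloc I) (λ y → TruncFeasible I y × (𝔼 (Instance.D I) (λ d → obj I (xs d)) ≤ obj I y))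
lemma1 I xs feasible =
  expectedAlloc I xs , expectedAlloc-truncFeasible I feasible , ≤-reflexive (𝔼-obj I xs)
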